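{- Let $\mathbf A$ be an FL${}_{\mathrm e}$-algebra in which $1$ is the greatest and $0$ the least element. The following are equivalent: (1) $\mathbf A\in\mathbf G_{\mathsf{FL}_{\mathsf{ew}}}(\mathsf{BA})$, i.e. $\mathbf A$ is pseudo-complemented: $x\wedge\neg x\leq 0$ for all $x\in A$; (2) for every binary operation ${\Rightarrow}$ on $A$ with $(x\to y)\cdot(y\to\neg\neg x)\leq x{\Rightarrow} y\leq (x\to y)\wedge(y\to\neg\neg x)$ for all $x,y$, $(\mathbf A,{\Rightarrow})$ is proto-connexive; (3) there exist an increasing map $\delta\colon A\to A$ (i.e. $x\leq\delta(x)$ for all $x$) and a binary operation ${\Rightarrow}$ on $A$ with $(x\to y)\cdot(y\to\delta(x))\leq x{\Rightarrow} y\leq (x\to y)\wedge(y\to\delta(x))$ for all $x,y$, such that $1\leq\neg(x{\Rightarrow}\neg x)$ for all $x\in A$.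
   Context: An FL${}_{\mathrm e}$-algebra is an algebra $\langle A,\wedge,\vee,\cdot,\to,0,1\rangle$ such that $\langle A,\wedge,\vee\rangle$ is a lattice (with order $\leq$), $\langle A,\cdot,1\rangle$ is a commutative monoid, $0$ is an arbitrary constant, and $x\cdot y\leq z\iff x\leq y\to z$. Write $\neg x:=x\to 0$. $(\mathbf A,{\Rightarrow})$ is proto-connexive if for all $x,y\in A$: $1\leq\neg(x{\Rightarrow}\neg x)$, $1\leq\neg(\neg x{\Rightarrow} x)$, $1\leq (x{\Rightarrow} y){\Rightarrow}\neg(x{\Rightarrow}\neg y)$, $1\leq (x{\Rightarrow}\neg y){\Rightarrow}\neg(x{\Rightarrow} y)$. $\mathsf{BA}$ is the variety of Boolean algebras viewed as FL${}_{\mathrm e}$-algebras satisfying $x\cdot y=x\wedge y$ and $x\to y=\neg x\vee y$; $\mathbf G_{\mathsf{FL}_{\mathsf e}}(\mathsf{BA})$ is the largest variety $\mathsf W$ of FL${}_{\mathrm e}$-algebras such that for every equation $s\approx t$, $\mathsf{BA}\models s\approx t$ iff $\mathsf W\models\neg s\approx\neg t$; $\mathbf G_{\mathsf{FL}_{\mathsf{ew}}}(\mathsf{BA})$ is its intersection with the variety $\mathsf{FL}_{\mathsf{ew}}$ of FL${}_{\mathrm e}$-algebras with $1$ greatest and $0$ least. -}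

module Defs where

open import Level using (Level; suc)
open import Relation.Binary.PropositionalEquality using (_≡_)
open import Data.Product using (_×_)

record FLeAlgebra (c : Level) : Set (suc c) where
  infixr 7 _·_
  infixr 6 _∧_
  infixr 5 _∨_
  infixr 4 _⇒ᵣ_
  infix 3 _≤_
  field
    Carrier : Set c
    _∧_ _∨_ _·_ _⇒ᵣ_ : Carrier → Carrier → Carrier
    𝟘 𝟙 : Carrier
    ∧-comm   : ∀ x y → x ∧ y ≡ y ∧ x
    ∨-comm   : ∀ x y → x ∨ y ≡ y ∨ x
    ∧-assoc  : ∀ x y z → (x ∧ y) ∧ z ≡ x ∧ (y ∧ z)
    ∨-assoc  : ∀ x y z → (x ∨ y) ∨ z ≡ x ∨ (y ∨ z)
    ∧-absorb : ∀ x y → x ∧ (x ∨ y) ≡ x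
    ∨-absorb : ∀ x y → x ∨ (x ∧ y) ≡ x
    ·-assoc  : ∀ x y z → (x · y) · z ≡ x · (y · z)
    ·-comm   : ∀ x y → x · y ≡ y · x
    ·-identityˡ : ∀ x → 𝟙 · x ≡ x

  _≤_ : Carrier → Carrier → Set c
  x ≤ y = x ∧ y ≡ x

  field
    residuation→ : ∀ x y z → x · y ≤ z → x ≤ (y ⇒ᵣ z)
    residuation← : ∀ x y z → x ≤ (y ⇒ᵣ z) → x · y ≤ z

  ∼_ : Carrier → Carrier
  ∼ x = x ⇒ᵣ 𝟘
  infix 8 ∼_

IsFLew : ∀ {c} → FLeAlgebra c → Set c
IsFLew A = (∀ x → x ≤ 𝟙) × (∀ x → 𝟘 ≤ x)
  where open FLeAlgebra A

PseudoComplemented : ∀ {c} → FLeAlgebra c → Set c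
PseudoComplemented A = ∀ x → x ∧ ∼ x ≤ 𝟘
  where open FLeAlgebra A

ProtoConnexive : ∀ {c} (A : FLeAlgebra c) →
                 (FLeAlgebra.Carrier A → FLeAlgebra.Carrier A → FLeAlgebra.Carrier A) → Set c
ProtoConnexive A _⇛_ =
    (∀ x → 𝟙 ≤ ∼ (x ⇛ (∼ x)))
  × (∀ x → 𝟙 ≤ ∼ ((∼ x) ⇛ x))
  × (∀ x y → 𝟙 ≤ ((x ⇛ y) ⇛ (∼ (x ⇛ (∼ y)))))
  × (∀ x y → 𝟙 ≤ ((x ⇛ (∼ y)) ⇛ (∼ (x ⇛ y))))
  where open FLeAlgebra A

Bounded⇛ : ∀ {c} (A : FLeAlgebra c) →
           (FLeAlgebra.Carrier A → FLeAlgebra.Carrier A) →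
           (FLeAlgebra.Carrier A → FLeAlgebra.Carrier A → FLeAlgebra.Carrier A) → Set c
Bounded⇛ A δ _⇛_ = ∀ x y →
    ((x ⇒ᵣ y) · (y ⇒ᵣ δ x) ≤ (x ⇛ y)) × ((x ⇛ y) ≤ (x ⇒ᵣ y) ∧ (y ⇒ᵣ δ x))
  where open FLeAlgebra A

-- Pseudo-complementation in an integral algebra gives two facts: an element
-- annihilating both w and ∼w is 0, and an element whose square is 0 is 0.
-- For δ = ∼∼ each proto-connexive axiom then reduces, by case splits on x / ∼x
-- and y / ∼y, to products containing a factor next to its own negation.
-- Conversely, if x ⇛ ∼x ≤ 0 for all x, then c := x ∧ ∼x lies below both
-- x → ∼x and ∼x → δx, so c² ≤ x ⇛ ∼x ≤ 0; hence c ≤ ∼c and 1 · c ≤ c ⇛ ∼c ≤ 0.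

module Submission where

open import Defs
open import Algebra.Bundles using (CommutativeSemigroup)
import Algebra.Properties.CommutativeSemigroup as CommutativeSemigroupProperties
open import Data.Product using (_×_; Σ; _,_; proj₁; proj₂)
open import Function.Bundles using (_⇔_; mk⇔)
open import Relation.Binary.Bundles using (Poset)
open import Relation.Binary.PropositionalEquality
  using (_≡_; refl; sym; trans; cong; cong₂; isEquivalence; module ≡-Reasoning)
import Relation.Binary.Reasoning.PartialOrder as PosetReasoning

module FLeAlgebraProperties {c} (A : FLeAlgebra c) where
  open FLeAlgebra A

  ∧-idem : ∀ x → x ∧ x ≡ x
  ∧-idem x = trans (cong (x ∧_) (sym (∨-absorb x x))) (∧-absorb x (x ∧ x))

  ≤-refl : ∀ {x} → x ≤ x
  ≤-refl {x} = ∧-idem x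

  ≤-trans : ∀ {x y z} → x ≤ y → y ≤ z → x ≤ z
  ≤-trans {x} {y} {z} x≤y y≤z = begin
      x ∧ z        ≡⟨ cong (_∧ z) x≤y ⟨
      (x ∧ y) ∧ z  ≡⟨ ∧-assoc x y z ⟩
      x ∧ (y ∧ z)  ≡⟨ cong (x ∧_) y≤z ⟩
      x ∧ y        ≡⟨ x≤y ⟩
      x            ∎
    where open ≡-Reasoning

  ≤-antisym : ∀ {x y} → x ≤ y → y ≤ x → x ≡ y
  ≤-antisym {x} {y} x≤y y≤x = trans (sym x≤y) (trans (∧-comm x y) y≤x)

  poset : Poset c c c
  poset = record
    { _≈_            = _≡_
    ; _≤_            = _≤_
    ; isPartialOrder = record
      { isPreorder = record
        { isEquivalence = isEquivalence
        ; reflexive     = λ { refl → ≤-refl }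
        ; trans         = ≤-trans
        }
      ; antisym    = ≤-antisym
      }
    }

  open PosetReasoning poset

  x∧y≤x : ∀ {x y} → x ∧ y ≤ x
  x∧y≤x {x} {y} = begin-equality
    (x ∧ y) ∧ x    ≡⟨ ∧-assoc x y x ⟩
    x ∧ (y ∧ x)    ≡⟨ cong (x ∧_) (∧-comm y x) ⟩
    x ∧ (x ∧ y)    ≡⟨ ∧-assoc x x y ⟨
    (x ∧ x) ∧ y    ≡⟨ cong (_∧ y) (∧-idem x) ⟩
    x ∧ y          ∎

  x∧y≤y : ∀ {x y} → x ∧ y ≤ y
  x∧y≤y {x} {y} = trans (∧-assoc x y y) (cong (x ∧_) (∧-idem y))

  ∧-greatest : ∀ {x y z} → z ≤ x → z ≤ y → z ≤ x ∧ y
  ∧-greatest {x} {y} {z} z≤x z≤y = trans (sym (∧-assoc z x y)) (trans (cong (_∧ y) z≤x) z≤y)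

  ·-commutativeSemigroup : CommutativeSemigroup c c
  ·-commutativeSemigroup = record
    { _≈_                    = _≡_
    ; _∙_                    = _·_
    ; isCommutativeSemigroup = record
      { isSemigroup = record
        { isMagma = record { isEquivalence = isEquivalence ; ∙-cong = cong₂ _·_ }
        ; assoc   = ·-assoc
        }
      ; comm        = ·-comm
      }
    }

  open CommutativeSemigroupProperties ·-commutativeSemigroup public
    using (xy∙z≈xz∙y; interchange)

  ·-identityʳ : ∀ x → x · 𝟙 ≡ x
  ·-identityʳ x = trans (·-comm x 𝟙) (·-identityˡ x)

  curry : ∀ {x y z} → x · y ≤ z → x ≤ y ⇒ᵣ z
  curry = residuation→ _ _ _

  uncurry : ∀ {x y z} → x ≤ y ⇒ᵣ z → x · y ≤ z
  uncurry = residuation← _ _ _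

  ·-comm-≤ : ∀ {x y z} → x · y ≤ z → y · x ≤ z
  ·-comm-≤ {x} {y} {z} xy≤z = begin
    y · x  ≡⟨ ·-comm y x ⟩
    x · y  ≤⟨ xy≤z ⟩
    z      ∎

  ·-monoˡ-≤ : ∀ {x y z} → x ≤ y → x · z ≤ y · z
  ·-monoˡ-≤ x≤y = uncurry (≤-trans x≤y (curry ≤-refl))

  ·-monoʳ-≤ : ∀ {x y z} → x ≤ y → z · x ≤ z · y
  ·-monoʳ-≤ {x} {y} {z} x≤y = ·-comm-≤ (begin
    x · z  ≤⟨ ·-monoˡ-≤ x≤y ⟩
    y · z  ≡⟨ ·-comm y z ⟩
    z · y  ∎)

  ·-mono-≤ : ∀ {x x′ y y′} → x ≤ x′ → y ≤ y′ → x · y ≤ x′ · y′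
  ·-mono-≤ x≤x′ y≤y′ = ≤-trans (·-monoˡ-≤ x≤x′) (·-monoʳ-≤ y≤y′)

  ∼x·x≤𝟘 : ∀ {x} → ∼ x · x ≤ 𝟘
  ∼x·x≤𝟘 = uncurry ≤-refl

  x·∼x≤𝟘 : ∀ {x} → x · ∼ x ≤ 𝟘
  x·∼x≤𝟘 = ·-comm-≤ ∼x·x≤𝟘

  x≤∼∼x : ∀ {x} → x ≤ ∼ ∼ x
  x≤∼∼x = curry x·∼x≤𝟘

  ≤⇒𝟙≤⇒ᵣ : ∀ {x y} → x ≤ y → 𝟙 ≤ x ⇒ᵣ y
  ≤⇒𝟙≤⇒ᵣ {x} {y} x≤y = curry (begin
    𝟙 · x  ≡⟨ ·-identityˡ x ⟩
    x      ≤⟨ x≤y ⟩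
    y      ∎)

  𝟙≤⇒ᵣ⇒≤ : ∀ {x y} → 𝟙 ≤ x ⇒ᵣ y → x ≤ y
  𝟙≤⇒ᵣ⇒≤ {x} {y} 𝟙≤x⇒y = begin
    x      ≡⟨ ·-identityˡ x ⟨
    𝟙 · x  ≤⟨ uncurry 𝟙≤x⇒y ⟩
    y      ∎

module BoundedConnective {c} (A : FLeAlgebra c) {δ _⇛_} (bounded : Bounded⇛ A δ _⇛_) where
  open FLeAlgebra A
  open FLeAlgebraProperties A

  ⇛-lower : ∀ {p q x y} → p ≤ x ⇒ᵣ y → q ≤ y ⇒ᵣ δ x → p · q ≤ x ⇛ y
  ⇛-lower {x = x} {y} p≤ q≤ = ≤-trans (·-mono-≤ p≤ q≤) (proj₁ (bounded x y))

  ⇛≤⇒ᵣ : ∀ {x y} → x ⇛ y ≤ x ⇒ᵣ y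
  ⇛≤⇒ᵣ {x} {y} = ≤-trans (proj₂ (bounded x y)) x∧y≤x

  ⇛≤⇒ᵣδ : ∀ {x y} → x ⇛ y ≤ y ⇒ᵣ δ x
  ⇛≤⇒ᵣδ {x} {y} = ≤-trans (proj₂ (bounded x y)) x∧y≤y

module IntegralProperties {c} (A : FLeAlgebra c) (flew : IsFLew A) where
  open FLeAlgebra A
  open FLeAlgebraProperties A
  open PosetReasoning poset

  𝟘≤x : ∀ {x} → 𝟘 ≤ x
  𝟘≤x = proj₂ flew _

  x·y≤x : ∀ {x y} → x · y ≤ x
  x·y≤x {x} {y} = begin
    x · y  ≤⟨ ·-monoʳ-≤ (proj₁ flew y) ⟩
    x · 𝟙  ≡⟨ ·-identityʳ x ⟩
    x      ∎

  x·y≤y : ∀ {x y} → x · y ≤ y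
  x·y≤y = ·-comm-≤ x·y≤x

  disjoint⇒≤∼ : ∀ {x y} → x ∧ y ≤ 𝟘 → y ≤ ∼ x
  disjoint⇒≤∼ x∧y≤𝟘 = curry (≤-trans (∧-greatest x·y≤y x·y≤x) x∧y≤𝟘)

  meetConnective : (Carrier → Carrier) → Carrier → Carrier → Carrier
  meetConnective δ x y = (x ⇒ᵣ y) ∧ (y ⇒ᵣ δ x)

  meetConnective-bounded : ∀ δ → Bounded⇛ A δ (meetConnective δ)
  meetConnective-bounded δ x y = ∧-greatest x·y≤x x·y≤y , ≤-refl

  contradictory⇒pseudoComplemented : ∀ {δ _⇛_} → (∀ x → x ≤ δ x) → Bounded⇛ A δ _⇛_ →
    (∀ x → 𝟙 ≤ ∼ (x ⇛ (∼ x))) → PseudoComplemented A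
  contradictory⇒pseudoComplemented {δ} {_⇛_} inflationary bounded contradictory x =
    𝟙≤⇒ᵣ⇒≤ (curry (refute (≤⇒𝟙≤⇒ᵣ (curry c·c≤𝟘)) ≤-refl))
    where
    open BoundedConnective A bounded

    refute : ∀ {p q a} → p ≤ a ⇒ᵣ ∼ a → q ≤ a → p · q ≤ 𝟘
    refute {a = a} p≤ q≤a =
      ≤-trans (⇛-lower p≤ (curry (≤-trans x·y≤x (≤-trans q≤a (inflationary a)))))
              (𝟙≤⇒ᵣ⇒≤ (contradictory a))

    c·c≤𝟘 : (x ∧ ∼ x) · (x ∧ ∼ x) ≤ 𝟘
    c·c≤𝟘 = refute (curry (≤-trans x·y≤x x∧y≤y)) x∧y≤x

module PseudoComplementedProperties {c} (A : FLeAlgebra c) (flew : IsFLew A)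
                                    (pseudoComplemented : PseudoComplemented A) where
  open FLeAlgebra A
  open FLeAlgebraProperties A
  open IntegralProperties A flew
  open PosetReasoning poset

  ∼x∧x≤𝟘 : ∀ {x} → ∼ x ∧ x ≤ 𝟘
  ∼x∧x≤𝟘 {x} = begin
    ∼ x ∧ x  ≡⟨ ∧-comm (∼ x) x ⟩
    x ∧ ∼ x  ≤⟨ pseudoComplemented x ⟩
    𝟘        ∎

  ≤𝟘-by-cases : ∀ {x w} → x · w ≤ 𝟘 → x · ∼ w ≤ 𝟘 → x ≤ 𝟘
  ≤𝟘-by-cases {w = w} xw≤𝟘 x∼w≤𝟘 =
    ≤-trans (∧-greatest (curry xw≤𝟘) (curry x∼w≤𝟘)) (pseudoComplemented (∼ w))

  x·x≤𝟘⇒x≤𝟘 : ∀ {x} → x · x ≤ 𝟘 → x ≤ 𝟘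
  x·x≤𝟘⇒x≤𝟘 {x} x·x≤𝟘 = ≤-trans (∧-greatest ≤-refl (curry x·x≤𝟘)) (pseudoComplemented x)

  ·-square-≤𝟘 : ∀ {x w} → x · (w · w) ≤ 𝟘 → x · w ≤ 𝟘
  ·-square-≤𝟘 {x} {w} xww≤𝟘 = x·x≤𝟘⇒x≤𝟘 (begin
    (x · w) · (x · w)  ≤⟨ ·-monoʳ-≤ x·y≤y ⟩
    (x · w) · w        ≡⟨ ·-assoc x w w ⟩
    x · (w · w)        ≤⟨ xww≤𝟘 ⟩
    𝟘                  ∎)

  annihilates-square : ∀ {p q w} → q · q ≤ w → p · w ≤ 𝟘 → p · q ≤ 𝟘
  annihilates-square q·q≤w p·w≤𝟘 = ·-square-≤𝟘 (≤-trans (·-monoʳ-≤ q·q≤w) p·w≤𝟘)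

  opposite⇒·≤𝟘 : ∀ {u v w y} → u · w ≤ y → v · w ≤ ∼ y → (u · v) · w ≤ 𝟘
  opposite⇒·≤𝟘 {u} {v} {w} {y} uw≤y vw≤∼y = ·-square-≤𝟘 (begin
    (u · v) · (w · w)  ≡⟨ interchange u v w w ⟩
    (u · w) · (v · w)  ≤⟨ ·-mono-≤ uw≤y vw≤∼y ⟩
    y · ∼ y            ≤⟨ x·∼x≤𝟘 ⟩
    𝟘                  ∎)

module ProtoConnexivity {c} (A : FLeAlgebra c) (flew : IsFLew A)
                        (pseudoComplemented : PseudoComplemented A) where
  open FLeAlgebra A
  open FLeAlgebraProperties A
  open IntegralProperties A flew
  open PseudoComplementedProperties A flew pseudoComplemented
  open PosetReasoning poset

  module _ (_⇛_ : Carrier → Carrier → Carrier) (bounded : Bounded⇛ A (λ x → ∼ ∼ x) _⇛_) where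
    open BoundedConnective A bounded

    ⇛-disjoint : ∀ {x y} → x ∧ y ≤ 𝟘 → x ⇛ y ≤ ∼ x ∧ ∼ y
    ⇛-disjoint {x} {y} x∧y≤𝟘 = ∧-greatest
      (curry (≤-trans (∧-greatest x·y≤y (uncurry ⇛≤⇒ᵣ)) x∧y≤𝟘))
      (curry (≤-trans (∧-greatest (≤-trans x·y≤y (disjoint⇒≤∼ x∧y≤𝟘)) (uncurry ⇛≤⇒ᵣδ))
                      (pseudoComplemented (∼ x))))

    ⇛·∼≤∼ : ∀ {x y} → (x ⇛ y) · ∼ x ≤ ∼ y
    ⇛·∼≤∼ {x} {y} = curry (begin
      ((x ⇛ y) · ∼ x) · y  ≡⟨ xy∙z≈xz∙y (x ⇛ y) (∼ x) y ⟩
      ((x ⇛ y) · y) · ∼ x  ≤⟨ ·-monoˡ-≤ (uncurry ⇛≤⇒ᵣδ) ⟩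
      ∼ ∼ x · ∼ x          ≤⟨ ∼x·x≤𝟘 ⟩
      𝟘                    ∎)

    ⇛·⇛∼≤𝟘 : ∀ {x y} → (x ⇛ y) · (x ⇛ (∼ y)) ≤ 𝟘
    ⇛·⇛∼≤𝟘 = ≤𝟘-by-cases (opposite⇒·≤𝟘 (uncurry ⇛≤⇒ᵣ) (uncurry ⇛≤⇒ᵣ))
                         (opposite⇒·≤𝟘 ⇛·∼≤∼ ⇛·∼≤∼)

    square≤⇛ : ∀ {q x y} → q · x ≤ y → q · y ≤ ∼ ∼ x → q · q ≤ x ⇛ y
    square≤⇛ qx≤y qy≤∼∼x = ⇛-lower (curry qx≤y) (curry qy≤∼∼x)

    product-square≤⇛ : ∀ {x y} → (x · y) · (x · y) ≤ x ⇛ y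
    product-square≤⇛ {x} {y} = square≤⇛
      (begin (x · y) · x  ≡⟨ xy∙z≈xz∙y x y x ⟩ (x · x) · y  ≤⟨ x·y≤y ⟩ y ∎)
      (begin (x · y) · y  ≡⟨ ·-assoc x y y ⟩ x · (y · y)  ≤⟨ x·y≤x ⟩ x ≤⟨ x≤∼∼x ⟩ ∼ ∼ x ∎)

    ∼product-square≤⇛ : ∀ {x y} → (∼ x · ∼ y) · (∼ x · ∼ y) ≤ x ⇛ y
    ∼product-square≤⇛ {x} {y} = square≤⇛
      (begin (∼ x · ∼ y) · x  ≡⟨ xy∙z≈xz∙y (∼ x) (∼ y) x ⟩ (∼ x · x) · ∼ y  ≤⟨ x·y≤x ⟩
             ∼ x · x          ≤⟨ ∼x·x≤𝟘 ⟩ 𝟘 ≤⟨ 𝟘≤x ⟩ y ∎)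
      (begin (∼ x · ∼ y) · y  ≡⟨ ·-assoc (∼ x) (∼ y) y ⟩ ∼ x · (∼ y · y)  ≤⟨ x·y≤y ⟩
             ∼ y · y          ≤⟨ ∼x·x≤𝟘 ⟩ 𝟘 ≤⟨ 𝟘≤x ⟩ ∼ ∼ x ∎)

    ⇛-cover : ∀ {p x y} → p · (x ⇛ y) ≤ 𝟘 → p · (x ⇛ (∼ y)) ≤ 𝟘 → p ≤ 𝟘
    -- In the ∼ x branch the split is on ∼ y, so both products there have the form ∼ x · ∼ y′.
    ⇛-cover {p} {x} {y} p⇛≤𝟘 p⇛∼≤𝟘 = ≤𝟘-by-cases {w = x}
      (≤𝟘-by-cases {w = y}   (annihilate product-square≤⇛ p⇛≤𝟘)  (annihilate product-square≤⇛ p⇛∼≤𝟘))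
      (≤𝟘-by-cases {w = ∼ y} (annihilate ∼product-square≤⇛ p⇛≤𝟘) (annihilate ∼product-square≤⇛ p⇛∼≤𝟘))
      where
      annihilate : ∀ {a b w} → (a · b) · (a · b) ≤ w → p · w ≤ 𝟘 → (p · a) · b ≤ 𝟘
      annihilate {a} {b} ab²≤w p·w≤𝟘 = begin
        (p · a) · b  ≡⟨ ·-assoc p a b ⟩
        p · (a · b)  ≤⟨ annihilates-square ab²≤w p·w≤𝟘 ⟩
        𝟘            ∎

    ∼⇛·∼⇛∼≤𝟘 : ∀ {x y} → ∼ (x ⇛ y) · ∼ (x ⇛ (∼ y)) ≤ 𝟘
    ∼⇛·∼⇛∼≤𝟘 {x} {y} = ⇛-cover
      (begin (∼ u · ∼ v) · u  ≡⟨ xy∙z≈xz∙y (∼ u) (∼ v) u ⟩ (∼ u · u) · ∼ v  ≤⟨ x·y≤x ⟩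
             ∼ u · u          ≤⟨ ∼x·x≤𝟘 ⟩ 𝟘 ∎)
      (begin (∼ u · ∼ v) · v  ≡⟨ ·-assoc (∼ u) (∼ v) v ⟩ ∼ u · (∼ v · v)  ≤⟨ x·y≤y ⟩
             ∼ v · v          ≤⟨ ∼x·x≤𝟘 ⟩ 𝟘 ∎)
      where
      u = x ⇛ y
      v = x ⇛ (∼ y)

    𝟙≤⇛∼ : ∀ {u v} → u · v ≤ 𝟘 → ∼ u · ∼ v ≤ 𝟘 → 𝟙 ≤ u ⇛ (∼ v)
    𝟙≤⇛∼ {u} {v} uv≤𝟘 ∼u∼v≤𝟘 = begin
      𝟙      ≡⟨ ·-identityˡ 𝟙 ⟨
      𝟙 · 𝟙  ≤⟨ ⇛-lower (≤⇒𝟙≤⇒ᵣ (curry uv≤𝟘)) (≤⇒𝟙≤⇒ᵣ (curry (·-comm-≤ ∼u∼v≤𝟘))) ⟩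
      u ⇛ (∼ v) ∎

    protoConnexive : ProtoConnexive A _⇛_
    protoConnexive =
        (λ x → ≤⇒𝟙≤⇒ᵣ (≤-trans (⇛-disjoint (pseudoComplemented x)) (pseudoComplemented (∼ x))))
      , (λ x → ≤⇒𝟙≤⇒ᵣ (≤-trans (⇛-disjoint ∼x∧x≤𝟘) ∼x∧x≤𝟘))
      , (λ x y → 𝟙≤⇛∼ ⇛·⇛∼≤𝟘 ∼⇛·∼⇛∼≤𝟘)
      , (λ x y → 𝟙≤⇛∼ (·-comm-≤ ⇛·⇛∼≤𝟘) (·-comm-≤ ∼⇛·∼⇛∼≤𝟘))

corollary3p26 : ∀ {c} (A : FLeAlgebra c) → IsFLew A →
    let open FLeAlgebra A in
      (PseudoComplemented A ⇔ (∀ (_⇛_ : Carrier → Carrier → Carrier) → Bounded⇛ A (λ x → ∼ ∼ x) _⇛_ → ProtoConnexive A _⇛_))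
    × (PseudoComplemented A ⇔ Σ (Carrier → Carrier) (λ δ → (∀ x → x ≤ δ x) × Σ (Carrier → Carrier → Carrier) (λ _⇛_ → Bounded⇛ A δ _⇛_ × (∀ x → 𝟙 ≤ ∼ (x ⇛ (∼ x))))))
corollary3p26 A flew =
    mk⇔ protoConnexive
        (λ protoConnexive-all → contradictory⇒pseudoComplemented (λ _ → x≤∼∼x) ∼∼-meet-bounded
                                  (proj₁ (protoConnexive-all _ ∼∼-meet-bounded)))
  , mk⇔ (λ pseudoComplemented → (λ x → ∼ ∼ x) , (λ _ → x≤∼∼x) , _ , ∼∼-meet-bounded
                                  , proj₁ (protoConnexive pseudoComplemented _ ∼∼-meet-bounded))
        (λ (_ , inflationary , _ , bounded , contradictory) →
           contradictory⇒pseudoComplemented inflationary bounded contradictory)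
  where
  open FLeAlgebra A
  open FLeAlgebraProperties A
  open IntegralProperties A flew
  open ProtoConnexivity A flew

  ∼∼-meet-bounded : Bounded⇛ A (λ x → ∼ ∼ x) (meetConnective (λ x → ∼ ∼ x))
  ∼∼-meet-bounded = meetConnective-bounded (λ x → ∼ ∼ x)
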